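{- In any IK-CPS model, for every world $w$ and all formulas $A, B$, the following hold (constructively): (unit) if $w\Vdash_s A$ then $w \Vdash A$; (bind) if for all $w'\ge w$, $w'\Vdash_s A$ implies $w'\Vdash B$, then $w\Vdash A$ implies $w\Vdash B$.
   Context: Formulas are those of first-order predicate logic built from atomic formulas with $\wedge, \vee, \Rightarrow, \forall, \exists$. An IK-CPS model consists of: a preorder $(K,\le)$ of worlds; a binary relation $w \Vdash_\bot^{C}$ between worlds $w$ and formulas $C$ ("exploding"); a relation $w \Vdash_s X$ (strong forcing) between worlds and atomic formulas, monotone in $w$; and sets $D(w)$ with $D(w)\subseteq D(w')$ for $w'\ge w$. Strong forcing is extended to composite formulas simultaneously with forcing $\Vdash$: $w \Vdash A$ iff for every formula $C$ and every $w'\ge w$, if for all $w''\ge w'$ ($w''\Vdash_s A$ implies $w''\Vdash_\bot^{C}$), then $w'\Vdash_\bot^{C}$; $w\Vdash_s A\wedge B$ iff $w\Vdash A$ and $w\Vdash B$; $w\Vdash_s A\vee B$ iff $w\Vdash A$ or $w\Vdash B$; $w\Vdash_s A\Rightarrow B$ iff for all $w'\ge w$, $w'\Vdash A$ implies $w'\Vdash B$; $w\Vdash_s \forall x.A(x)$ iff for all $w'\ge w$ and $t\in D(w')$, $w'\Vdash A(t)$; $w\Vdash_s \exists x.A(x)$ iff $w\Vdash A(t)$ for some $t\in D(w)$. -}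

module Defs where

open import Data.Product using (_×_; Σ; _,_)
open import Data.Sum using (_⊎_)
open import Relation.Binary.Structures using (IsPreorder)
open import Relation.Binary.PropositionalEquality using (_≡_)

-- Binders are represented in
-- higher-order abstract syntax: the body of a quantifier is a function from
-- terms to formulas, so A(t) is literally application  A t .
module Syntax (Atom : Set) (Term : Set) where

  infixr 6 _∧'_
  infixr 5 _∨'_
  infixr 4 _⇒'_

  data Fm : Set where
    atom  : Atom → Fm
    _∧'_  : Fm → Fm → Fm
    _∨'_  : Fm → Fm → Fm
    _⇒'_  : Fm → Fm → Fm
    ∀'    : (Term → Fm) → Fm
    ∃'    : (Term → Fm) → Fm

record IKCPS (Atom : Set) (Term : Set) : Set₁ where
  open Syntax Atom Term
  field
    K         : Set
    _≤_       : K → K → Set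
    ≤-pre     : IsPreorder _≡_ _≤_
    _⊩⊥_      : K → Fm → Set
    _⊩ₛᵃ_     : K → Atom → Set
    ⊩ₛᵃ-mono  : ∀ {w w′ X} → w ≤ w′ → w ⊩ₛᵃ X → w′ ⊩ₛᵃ X
    D         : K → Term → Set
    D-mono    : ∀ {w w′ t} → w ≤ w′ → D w t → D w′ t

  mutual
    _⊩_ : K → Fm → Set
    w ⊩ A = ∀ (C : Fm) (w′ : K) → w ≤ w′ →
              (∀ (w″ : K) → w′ ≤ w″ → w″ ⊩ₛ A → w″ ⊩⊥ C) →
              w′ ⊩⊥ C

    _⊩ₛ_ : K → Fm → Set
    w ⊩ₛ atom X  = w ⊩ₛᵃ X
    w ⊩ₛ (A ∧' B) = (w ⊩ A) × (w ⊩ B)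
    w ⊩ₛ (A ∨' B) = (w ⊩ A) ⊎ (w ⊩ B)
    w ⊩ₛ (A ⇒' B) = ∀ (w′ : K) → w ≤ w′ → w′ ⊩ A → w′ ⊩ B
    w ⊩ₛ ∀' A     = ∀ (w′ : K) → w ≤ w′ → (t : Term) → D w′ t → w′ ⊩ A t
    w ⊩ₛ ∃' A     = Σ Term (λ t → D w t × (w ⊩ A t))

module Submission where

open import Defs
open import Data.Product using (_×_; _,_)
open import Data.Sum using (inj₁; inj₂)
open import Relation.Binary.Structures using (IsPreorder)

module Forcing {Atom Term : Set} (M : IKCPS Atom Term) where
  open IKCPS M
  open Syntax Atom Term
  open IsPreorder ≤-pre using (refl; trans)

  ⊩-mono : ∀ {w w′} A → w ≤ w′ → w ⊩ A → w′ ⊩ A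
  ⊩-mono A w≤w′ w⊩A C w″ w′≤w″ = w⊩A C w″ (trans w≤w′ w′≤w″)

  ⊩ₛ-mono : ∀ {w w′} A → w ≤ w′ → w ⊩ₛ A → w′ ⊩ₛ A
  ⊩ₛ-mono (atom X) w≤w′ s = ⊩ₛᵃ-mono w≤w′ s
  ⊩ₛ-mono (A ∧' B) w≤w′ (a , b) = ⊩-mono A w≤w′ a , ⊩-mono B w≤w′ b
  ⊩ₛ-mono (A ∨' B) w≤w′ (inj₁ a) = inj₁ (⊩-mono A w≤w′ a)
  ⊩ₛ-mono (A ∨' B) w≤w′ (inj₂ b) = inj₂ (⊩-mono B w≤w′ b)
  ⊩ₛ-mono (A ⇒' B) w≤w′ f w″ w′≤w″ = f w″ (trans w≤w′ w′≤w″)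
  ⊩ₛ-mono (∀' A) w≤w′ f w″ w′≤w″ = f w″ (trans w≤w′ w′≤w″)
  ⊩ₛ-mono (∃' A) w≤w′ (t , d , a) = t , D-mono w≤w′ d , ⊩-mono (A t) w≤w′ a

  ⊩ₛ⇒⊩ : ∀ {w} A → w ⊩ₛ A → w ⊩ A
  ⊩ₛ⇒⊩ A w⊩ₛA C w′ w≤w′ k = k w′ refl (⊩ₛ-mono A w≤w′ w⊩ₛA)

  -- The continuation for A is built by running the one for B at every
  -- extension where A holds strongly.
  ⊩-bind : ∀ {w} A B →
           (∀ w′ → w ≤ w′ → w′ ⊩ₛ A → w′ ⊩ B) → w ⊩ A → w ⊩ B
  ⊩-bind A B h w⊩A C w′ w≤w′ k = w⊩A C w′ w≤w′ kA
    where
    kA : ∀ w″ → w′ ≤ w″ → w″ ⊩ₛ A → w″ ⊩⊥ C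
    kA w″ w′≤w″ w″⊩ₛA =
      h w″ (trans w≤w′ w′≤w″) w″⊩ₛA C w″ refl
        (λ w‴ w″≤w‴ → k w‴ (trans w′≤w″ w″≤w‴))

lemma8 : {Atom Term : Set} (M : IKCPS Atom Term) →
    (w : IKCPS.K M) (A B : Syntax.Fm Atom Term) →
    (IKCPS._⊩ₛ_ M w A → IKCPS._⊩_ M w A) ×
    ((∀ (w′ : IKCPS.K M) → IKCPS._≤_ M w w′ → IKCPS._⊩ₛ_ M w′ A → IKCPS._⊩_ M w′ B) →
    IKCPS._⊩_ M w A → IKCPS._⊩_ M w B)
lemma8 M w A B = ⊩ₛ⇒⊩ A , ⊩-bind A B
  where open Forcing M
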